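{- $\tilde c:=\inf_{\theta\in\mathbb{F}_q((1/t))}\ \sup_{\gamma\in\mathbb{F}_q((1/t))}\ \liminf_{0\ne N\in\mathbb{F}_q[t],\ |N|\to\infty}|N|\cdot|\langle N\theta-\gamma\rangle|=q^{ -2}$.
   Context: $q$ is a prime power, $\mathbb{F}_q[t]$ the polynomial ring over $\mathbb{F}_q$, and $\mathbb{F}_q((1/t))$ the field of Laurent series $\theta=\sum_i\theta_it^{ -i}$ with finitely many nonzero coefficients of positive powers of $t$. Absolute value: $|\theta|=q^{\deg\theta}$ with $\deg\theta=\max\{ -i:\theta_i\ne0\}$, $|0|=0$. Fractional part: $\langle\theta\rangle=\sum_{i\ge1}\theta_it^{ -i}$. The liminf is over the nonzero polynomials $N$. -}

module Defs where

open import Level using (0ℓ)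
open import Algebra.Bundles using (CommutativeRing)
open import Data.Nat as ℕ using (ℕ; zero; suc)
open import Data.Fin as Fin using (Fin; fromℕ; toℕ)
open import Data.Integer as ℤ using (ℤ; +_; -[1+_]; _≤_; _<_)
open import Data.Product using (Σ; ∃; _×_; _,_)
open import Relation.Nullary using (¬_)
import Relation.Binary.PropositionalEquality as P
open import Function.Bundles using (Inverse)

-- A finite field with exactly q elements: a commutative ring that is a field
-- (1 ≠ 0, nonzero elements invertible) whose carrier setoid is in bijection
-- with Fin q.  (q is then automatically a prime power.)
record IsFiniteField (R : CommutativeRing 0ℓ 0ℓ) (q : ℕ) : Set where
  open CommutativeRing R hiding (zero)
  field
    1≉0      : ¬ (1# ≈ 0#)
    inverses : ∀ x → ¬ (x ≈ 0#) → ∃ λ y → x * y ≈ 1#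
    count    : Inverse setoid (P.setoid (Fin q))

module LaurentSeries (R : CommutativeRing 0ℓ 0ℓ) where
  open CommutativeRing R hiding (zero)

  -- An element of F((1/t)):  θ = Σ_j coeff j · t^j, with coeff j = 0 for j large.
  record Laurent : Set where
    field
      coeff   : ℤ → Carrier
      bounded : ∃ λ (B : ℤ) → ∀ j → B < j → coeff j ≈ 0#
  open Laurent public

  record NonzeroPoly : Set where
    field
      deg   : ℕ
      cf    : Fin (suc deg) → Carrier
      lead≉0 : ¬ (cf (fromℕ deg) ≈ 0#)
  open NonzeroPoly public

  sumFin : ∀ {n} → (Fin n → Carrier) → Carrier
  sumFin {zero}  f = 0#
  sumFin {suc n} f = f Fin.zero + sumFin (λ i → f (Fin.suc i))

  -- coefficients of  N·θ − γ
  shiftedCoeff : NonzeroPoly → Laurent → Laurent → ℤ → Carrier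
  shiftedCoeff N θ γ j =
    sumFin (λ (k : Fin (suc (deg N))) → cf N k * coeff θ (j ℤ.- (+ toℕ k)))
      - coeff γ j

  -- coefficients of the fractional part ⟨x⟩ (keep only t^j with j ≤ −1)
  fracCoeff : (ℤ → Carrier) → ℤ → Carrier
  fracCoeff x j with j ℤ.<? + 0
  ... | Relation.Nullary.yes _ = x j
  ... | Relation.Nullary.no  _ = 0#

  -- |x| ≤ q^k   (x given by its coefficient function)
  AbsLe : (ℤ → Carrier) → ℤ → Set
  AbsLe x k = ∀ j → k < j → x j ≈ 0#

  -- |N| · |⟨Nθ − γ⟩| ≤ q^k      (|N| = q^{deg N})
  ProdLe : NonzeroPoly → Laurent → Laurent → ℤ → Set
  ProdLe N θ γ k = AbsLe (fracCoeff (shiftedCoeff N θ γ)) (k ℤ.- (+ deg N))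

  -- |N| · |⟨Nθ − γ⟩| ≥ q^k,  i.e. not ≤ q^(k−1)  (values lie in {0} ∪ q^ℤ)
  ProdGe : NonzeroPoly → Laurent → Laurent → ℤ → Set
  ProdGe N θ γ k = ¬ ProdLe N θ γ (k ℤ.- + 1)

  -- liminf_{|N|→∞} |N|·|⟨Nθ−γ⟩| ≥ q^k  (values discrete: eventually ≥ q^k)
  LiminfGe : Laurent → Laurent → ℤ → Set
  LiminfGe θ γ k = ¬ ¬ (∃ λ (R₀ : ℕ) → ∀ (N : NonzeroPoly) → R₀ ℕ.≤ deg N → ProdGe N θ γ k)

  -- liminf_{|N|→∞} |N|·|⟨Nθ−γ⟩| ≤ q^k  (infinitely often ≤ q^k)
  LiminfLe : Laurent → Laurent → ℤ → Set
  LiminfLe θ γ k = ∀ (R₀ : ℕ) → ¬ ¬ (∃ λ (N : NonzeroPoly) → (R₀ ℕ.≤ deg N) × ProdLe N θ γ k)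

-- Write θ and γ through their fractional digits a p and g p (the coefficients of
-- t ^ -(1 + p)).  For a polynomial N the p-th fractional digit of N θ is
-- Σ_k N_k a_(p + k), and |N| · |⟨N θ − γ⟩| ≤ q ^ -(1 + ℓ) says exactly that the first
-- deg N + ℓ fractional digits of N θ − γ vanish.
--
-- Lower bound.  The digits of γ are chosen greedily, g_n being chosen so that for no N
-- of degree < n the first n + 1 digits of N θ − γ vanish.  This works because,
-- inductively, if N and M of degree < n both make the first n digits vanish, they
-- agree in the next one: otherwise K = N − M is nonzero with K θ small, and reducing N
-- modulo K gives an N′ of degree < deg K making deg K + 1 digits vanish.
--
-- Upper bound.  For θ = Σ_i t ^ -(4 ^ i) and 4 ^ m = P + 1 the Hankel matrix
-- (a_(p + k))_(p, k ≤ P) vanishes below its anti-diagonal of ones, so every γ is matched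
-- in P + 1 digits by some N of degree ≤ P.  If deg N is too small, adding
-- t ^ (4 ^ (m − 1)) raises the degree without disturbing the matched digits.

module Submission where

open import Defs
open import Level using (0ℓ)
open import Algebra.Bundles using (CommutativeRing)
open import Data.Nat using (ℕ)
open import Data.Integer using (-[1+_])
open import Data.Product using (∃; _×_)
open import Relation.Nullary using (¬_)

open import Data.Empty using (⊥-elim)
open import Data.Fin as Fin using (Fin; toℕ)
import Data.Fin.Properties as Finₚ
open import Data.Integer as ℤ using (ℤ; +_)
open import Data.Nat as ℕ using (zero; suc; _∸_; _^_; _≤_; _<_; z≤n; s≤s; s≤s⁻¹)
open import Data.Nat.Induction using (<-rec)
import Data.Nat.Properties as ℕₚ
open ℕₚ using (≤-refl; ≤-trans; <-trans; ≤-<-trans; <⇒≤; ≤⇒≯; ≰⇒>; ≤∧≢⇒<; m≤n⇒m<n∨m≡n;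
               m<n⇒m<1+n; n≤1+n; n<1+n; m≤m+n; m≤n+m; +-monoʳ-<; +-monoˡ-≤; +-mono-≤;
               m≤n⇒∃[o]m+o≡n; m∸n+n≡m; m∸[m∸n]≡n; m∸n≤m; ^-monoʳ-≤; ^-monoʳ-<; m^n≢0; suc-pred;
               anyUpTo?; allUpTo?)
open import Data.Nat.Tactic.RingSolver using (solve-∀)
open import Data.Product using (_,_; proj₁; proj₂)
open import Data.Sum as Sum using (_⊎_; inj₁; inj₂)
open import Function using (_∘_)
open import Function.Bundles using (Inverse)
open import Function.Properties.Inverse using (Inverse⇒Injection)
open import Relation.Binary.Core using (Rel)
open import Relation.Binary.Definitions using (Decidable; _Respects_)
open import Relation.Binary.PropositionalEquality as ≡ using (_≡_)
open import Relation.Nullary using (Dec; yes; no)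
import Relation.Nullary.Decidable as Dec

-- Arithmetic

IsPowerOf4 : ℕ → Set
IsPowerOf4 y = ∃ λ i → 4 ^ i ≡ y

n<4^n : ∀ n → n < 4 ^ n
n<4^n zero    = s≤s z≤n
n<4^n (suc n) = +-mono-≤ (≤-trans (s≤s z≤n) (n<4^n n)) (≤-trans (n<4^n n) (m≤m+n _ _))

1+[n+n]<4*n : ∀ n .{{_ : ℕ.NonZero n}} → suc (n ℕ.+ n) < 4 ℕ.* n
1+[n+n]<4*n (suc n) = ≡.subst (suc (suc (suc n ℕ.+ suc n)) ≤_) (≡.sym (identity n)) (m≤m+n _ (n ℕ.+ n))
  where
    identity : ∀ n → 4 ℕ.* suc n ≡ suc (suc (suc n ℕ.+ suc n)) ℕ.+ (n ℕ.+ n)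
    identity = solve-∀

isPowerOf4? : ∀ y → Dec (IsPowerOf4 y)
isPowerOf4? y = Dec.map′ (λ (i , _ , 4^i≡y) → i , 4^i≡y)
                         (λ (i , 4^i≡y) → i , ≡.subst (i <_) 4^i≡y (n<4^n i) , 4^i≡y)
                         (anyUpTo? (λ i → 4 ^ i ℕ.≟ y) y)

powerOf4-gap : ∀ m {y} → 4 ^ m < y → y < 4 ^ suc m → ¬ IsPowerOf4 y
powerOf4-gap m lo hi (i , ≡.refl) with i ℕ.≤? m
... | yes i≤m = ≤⇒≯ (^-monoʳ-≤ 4 i≤m) lo
... | no  i≰m = ≤⇒≯ (^-monoʳ-≤ 4 (≰⇒> i≰m)) hi

-[1+m]-n≡-[1+m+n] : ∀ m n → -[1+ m ] ℤ.- + n ≡ -[1+ (m ℕ.+ n) ]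
-[1+m]-n≡-[1+m+n] m zero    = ≡.cong -[1+_] (≡.sym (ℕₚ.+-identityʳ m))
-[1+m]-n≡-[1+m+n] m (suc n) = ≡.cong -[1+_] (≡.sym (ℕₚ.+-suc m n))

-- Polynomials against the digits of a Laurent series

module Polynomials {r ℓ} (R : CommutativeRing r ℓ) where
  open CommutativeRing R hiding (zero)
  open import Algebra.Properties.Ring ring using (-‿distribˡ-*)
  open import Algebra.Properties.Group +-group using (\\-leftDividesˡ)
  open import Algebra.Properties.Semiring.Sum semiring
    using (sum; sum-cong-≋; sum-replicate-zero; ∑-distrib-+; *-distribˡ-sum)
  open import Relation.Binary.Reasoning.Setoid setoid

  Seq : Set r
  Seq = ℕ → Carrier

  infix 4 _≈ₛ_
  _≈ₛ_ : Rel Seq ℓ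
  N ≈ₛ M = ∀ k → N k ≈ M k

  VanishesFrom : ℕ → Seq → Set ℓ
  VanishesFrom n N = ∀ {k} → n ≤ k → N k ≈ 0#

  HasDegree : ℕ → Seq → Set ℓ
  HasDegree d N = VanishesFrom (suc d) N × ¬ N d ≈ 0#

  infixr 5 _∷ₛ_
  _∷ₛ_ : Carrier → Seq → Seq
  (c ∷ₛ N) zero    = c
  (c ∷ₛ N) (suc k) = N k

  shiftBy : ℕ → Seq → Seq
  shiftBy zero    N = N
  shiftBy (suc j) N = 0# ∷ₛ shiftBy j N

  monomial : ℕ → Seq
  monomial e = shiftBy e (1# ∷ₛ λ _ → 0#)

  _+[_]·_ : Seq → Carrier → Seq → Seq
  (N +[ c ]· M) k = N k + c * M k

  dot : ℕ → Seq → Seq → Carrier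
  dot n N b = sum {n = n} λ k → N (toℕ k) * b (toℕ k)

  -- The coefficient of t ^ -(1 + p) in N θ, where N vanishes from n and a p is the
  -- coefficient of t ^ -(1 + p) in θ.
  fracDigit : Seq → ℕ → Seq → ℕ → Carrier
  fracDigit a n N p = dot n N (λ k → a (p ℕ.+ k))

  Agrees : Seq → Seq → ℕ → ℕ → Seq → Set ℓ
  Agrees a g ℓ n N = ∀ {p} → p < ℓ → fracDigit a n N p ≈ g p

  ∷-congʳ : ∀ c {N M} → N ≈ₛ M → (c ∷ₛ N) ≈ₛ (c ∷ₛ M)
  ∷-congʳ c N≈M zero    = refl
  ∷-congʳ c N≈M (suc k) = N≈M k

  ∷-vanishesFrom : ∀ {n N} c → VanishesFrom n N → VanishesFrom (suc n) (c ∷ₛ N)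
  ∷-vanishesFrom c N↓ {suc k} (s≤s n≤k) = N↓ n≤k

  vanishesFrom-pred : ∀ {n N} → VanishesFrom (suc n) N → N n ≈ 0# → VanishesFrom n N
  vanishesFrom-pred N↓ Nn≈0 n≤k with m≤n⇒m<n∨m≡n n≤k
  ... | inj₁ n<k    = N↓ n<k
  ... | inj₂ ≡.refl = Nn≈0

  shiftBy-vanishesFrom : ∀ j {n N} → VanishesFrom n N → VanishesFrom (j ℕ.+ n) (shiftBy j N)
  shiftBy-vanishesFrom zero    N↓ = N↓
  shiftBy-vanishesFrom (suc j) N↓ = ∷-vanishesFrom 0# (shiftBy-vanishesFrom j N↓)

  shiftBy-below : ∀ j N {k} → k < j → shiftBy j N k ≈ 0#
  shiftBy-below (suc j) N {zero}  _         = refl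
  shiftBy-below (suc j) N {suc k} (s≤s k<j) = shiftBy-below j N k<j

  shiftBy-+ : ∀ j N k → shiftBy j N (j ℕ.+ k) ≡ N k
  shiftBy-+ zero    N k = ≡.refl
  shiftBy-+ (suc j) N k = shiftBy-+ j N k

  dot-cong : ∀ n {N M b b′} → (∀ {k} → k < n → N k ≈ M k) → (∀ {k} → k < n → b k ≈ b′ k) →
             dot n N b ≈ dot n M b′
  dot-cong n N≈M b≈b′ = sum-cong-≋ {n = n} λ i → *-cong (N≈M (Finₚ.toℕ<n i)) (b≈b′ (Finₚ.toℕ<n i))

  dot-vanishes : ∀ n {N b} → (∀ {k} → k < n → N k * b k ≈ 0#) → dot n N b ≈ 0#
  dot-vanishes n Nb≈0 = trans (sum-cong-≋ {n = n} λ i → Nb≈0 (Finₚ.toℕ<n i)) (sum-replicate-zero n)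

  dot-+[]· : ∀ n N c M b → dot n (N +[ c ]· M) b ≈ dot n N b + c * dot n M b
  dot-+[]· n N c M b = begin
    dot n (N +[ c ]· M) b
      ≈⟨ sum-cong-≋ {n = n} (λ i → let k = toℕ i in
                               trans (distribʳ (b k) (N k) (c * M k)) (+-congˡ (*-assoc c (M k) (b k)))) ⟩
    sum {n = n} (λ i → N (toℕ i) * b (toℕ i) + c * (M (toℕ i) * b (toℕ i)))
      ≈⟨ ∑-distrib-+ {n = n} _ _ ⟩
    dot n N b + sum {n = n} (λ i → c * (M (toℕ i) * b (toℕ i)))
      ≈⟨ +-congˡ (*-distribˡ-sum {n = n} c _) ⟨
    dot n N b + c * dot n M b
      ∎

  dot-extend : ∀ {n N} b → VanishesFrom n N → ∀ {m} → n ≤ m → dot m N b ≈ dot n N b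
  dot-extend {zero}  {N} b N↓ {m}     _         = dot-vanishes m {N} {b} λ _ → trans (*-congʳ (N↓ z≤n)) (zeroˡ _)
  dot-extend {suc n} {N} b N↓ {suc m} (s≤s n≤m) = +-congˡ (dot-extend {n} {N ∘ suc} (b ∘ suc) (N↓ ∘ s≤s) n≤m)

  dot-shiftBy : ∀ j n K b → dot (j ℕ.+ n) (shiftBy j K) b ≈ dot n K (λ k → b (j ℕ.+ k))
  dot-shiftBy zero    n K b = refl
  dot-shiftBy (suc j) n K b = begin
    0# * b 0 + dot (j ℕ.+ n) (shiftBy j K) (b ∘ suc) ≈⟨ +-congʳ (zeroˡ _) ⟩
    0# + dot (j ℕ.+ n) (shiftBy j K) (b ∘ suc)      ≈⟨ +-identityˡ _ ⟩
    dot (j ℕ.+ n) (shiftBy j K) (b ∘ suc)           ≈⟨ dot-shiftBy j n K (b ∘ suc) ⟩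
    dot n K (λ k → b (suc j ℕ.+ k))                 ∎

  agrees-respects : ∀ {a g ℓ n} → Agrees a g ℓ n Respects _≈ₛ_
  agrees-respects {a} {n = n} N≈M agrees {p} p<ℓ =
    trans (sym (dot-cong n {b = a ∘ (p ℕ.+_)} (λ {k} _ → N≈M k) (λ _ → refl))) (agrees p<ℓ)

  agrees-local : ∀ {a g g′ ℓ n N} → (∀ {p} → p < ℓ → g p ≡ g′ p) → Agrees a g ℓ n N → Agrees a g′ ℓ n N
  agrees-local g≡g′ agrees p<ℓ = trans (agrees p<ℓ) (reflexive (g≡g′ p<ℓ))

  solve-unitriangular : ∀ n (T : ℕ → Seq) → (∀ {i} → i < n → T i i ≈ 1#) →
                        (∀ {i k} → i < k → k < n → T i k ≈ 0#) →
                        (h : Seq) → ∃ λ N → VanishesFrom n N × (∀ {i} → i < n → dot n N (T i) ≈ h i)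
  solve-unitriangular zero    T _    _     h = (λ _ → 0#) , (λ _ → refl) , λ ()
  solve-unitriangular (suc n) T diag upper h = h 0 ∷ₛ N , ∷-vanishesFrom (h 0) N↓ , solves′
    where
      T′ : ℕ → Seq
      T′ i k = T (suc i) (suc k)

      h′ : Seq
      h′ i = - (T (suc i) 0 * h 0) + h (suc i)

      solution = solve-unitriangular n T′ (diag ∘ s≤s) (λ i<k k<n → upper (s≤s i<k) (s≤s k<n)) h′
      N      = proj₁ solution
      N↓     = proj₁ (proj₂ solution)
      solves = proj₂ (proj₂ solution)

      solves′ : ∀ {i} → i < suc n → dot (suc n) (h 0 ∷ₛ N) (T i) ≈ h i
      solves′ {zero} _ = begin
        h 0 * T 0 0 + dot n N (T 0 ∘ suc)
          ≈⟨ +-cong (*-congˡ (diag (s≤s z≤n)))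
                    (dot-vanishes n {N} {T 0 ∘ suc} λ k<n → trans (*-congˡ (upper (s≤s z≤n) (s≤s k<n))) (zeroʳ _)) ⟩
        h 0 * 1# + 0# ≈⟨ +-identityʳ _ ⟩
        h 0 * 1#      ≈⟨ *-identityʳ _ ⟩
        h 0           ∎
      solves′ {suc i} (s≤s i<n) = begin
        h 0 * T (suc i) 0 + dot n N (T′ i)                      ≈⟨ +-cong (*-comm _ _) (solves i<n) ⟩
        T (suc i) 0 * h 0 + (- (T (suc i) 0 * h 0) + h (suc i)) ≈⟨ \\-leftDividesˡ (T (suc i) 0 * h 0) (h (suc i)) ⟩
        h (suc i)                                               ∎

  hankel-solvable : ∀ P {a} → a P ≈ 1# → (∀ {x} → P < x → x ≤ P ℕ.+ P → a x ≈ 0#) →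
                    ∀ g → ∃ λ N → VanishesFrom (suc P) N × Agrees a g (suc P) (suc P) N
  hankel-solvable P {a} aP≈1 gap g = N , N↓ , agrees
    where
      -- Reversing the rows turns the Hankel matrix into a unitriangular one.
      T : ℕ → Seq
      T i k = a (P ∸ i ℕ.+ k)

      diag : ∀ {i} → i < suc P → T i i ≈ 1#
      diag (s≤s i≤P) = trans (reflexive (≡.cong a (m∸n+n≡m i≤P))) aP≈1

      upper : ∀ {i k} → i < k → k < suc P → T i k ≈ 0#
      upper {i} {k} i<k (s≤s k≤P) = gap (≡.subst (_< P ∸ i ℕ.+ k) (m∸n+n≡m i≤P) (+-monoʳ-< (P ∸ i) i<k))
                                        (+-mono-≤ (m∸n≤m P i) k≤P)
        where i≤P = ≤-trans (<⇒≤ i<k) k≤P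

      solution = solve-unitriangular (suc P) T diag upper (λ i → g (P ∸ i))
      N      = proj₁ solution
      N↓     = proj₁ (proj₂ solution)
      solves = proj₂ (proj₂ solution)

      agrees : Agrees a g (suc P) (suc P) N
      agrees {p} (s≤s p≤P) = begin
        fracDigit a (suc P) N p   ≈⟨ dot-cong (suc P) {N} (λ _ → refl)
                                       (λ {k} _ → reflexive (≡.cong (λ m → a (m ℕ.+ k)) (m∸[m∸n]≡n p≤P))) ⟨
        dot (suc P) N (T (P ∸ p)) ≈⟨ solves (s≤s (m∸n≤m P p)) ⟩
        g (P ∸ (P ∸ p))           ≡⟨ ≡.cong g (m∸[m∸n]≡n p≤P) ⟩
        g p                       ∎

  -- Subtracting multiples of t ^ j K from N changes the digits of N θ only from position
  -- V − j on, because those of K θ vanish below V.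
  module Reduction (a : Seq) {k K y} (K↓ : VanishesFrom (suc k) K) (unit : K k * y ≈ 1#)
                   {V} (Kθ-small : ∀ {p} → p < V → fracDigit a (suc k) K p ≈ 0#) where

    leading-cancels : ∀ x → x + - (x * y) * K k ≈ 0#
    leading-cancels x = begin
      x + - (x * y) * K k   ≈⟨ +-congˡ (-‿distribˡ-* (x * y) (K k)) ⟨
      x + - (x * y * K k)   ≈⟨ +-congˡ (-‿cong (*-assoc x y (K k))) ⟩
      x + - (x * (y * K k)) ≈⟨ +-congˡ (-‿cong (*-congˡ (trans (*-comm y (K k)) unit))) ⟩
      x + - (x * 1#)        ≈⟨ +-congˡ (-‿cong (*-identityʳ x)) ⟩
      x + - x               ≈⟨ -‿inverseʳ x ⟩
      0#                    ∎

    eliminate-leading : ∀ j N → VanishesFrom (suc (j ℕ.+ k)) N →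
      ∃ λ N′ → VanishesFrom (j ℕ.+ k) N′ ×
               (∀ {p} → p ℕ.+ j < V → fracDigit a (j ℕ.+ k) N′ p ≈ fracDigit a (suc (j ℕ.+ k)) N p)
    eliminate-leading j N N↓ = N′ , N′↓ , same
      where
        S  = shiftBy j K
        c  = - (N (j ℕ.+ k) * y)
        N′ = N +[ c ]· S

        S↓ : VanishesFrom (suc (j ℕ.+ k)) S
        S↓ = ≡.subst (λ m → VanishesFrom m S) (ℕₚ.+-suc j k) (shiftBy-vanishesFrom j K↓)

        N′↓ : VanishesFrom (j ℕ.+ k) N′
        N′↓ jk≤i with m≤n⇒m<n∨m≡n jk≤i
        ... | inj₁ jk<i   = trans (+-cong (N↓ jk<i) (trans (*-congˡ (S↓ jk<i)) (zeroʳ c))) (+-identityʳ 0#)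
        ... | inj₂ ≡.refl = trans (+-congˡ (*-congˡ (reflexive (shiftBy-+ j K k)))) (leading-cancels (N (j ℕ.+ k)))

        Sθ-small : ∀ {p} → p ℕ.+ j < V → fracDigit a (suc (j ℕ.+ k)) S p ≈ 0#
        Sθ-small {p} pj<V = begin
          dot (suc (j ℕ.+ k)) S (a ∘ (p ℕ.+_))      ≡⟨ ≡.cong (λ m → dot m S (a ∘ (p ℕ.+_))) (ℕₚ.+-suc j k) ⟨
          dot (j ℕ.+ suc k) S (a ∘ (p ℕ.+_))        ≈⟨ dot-shiftBy j (suc k) K (a ∘ (p ℕ.+_)) ⟩
          dot (suc k) K (λ i → a (p ℕ.+ (j ℕ.+ i))) ≈⟨ dot-cong (suc k) {K} (λ _ → refl)
                                                         (λ {i} _ → reflexive (≡.cong a (ℕₚ.+-assoc p j i))) ⟨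
          fracDigit a (suc k) K (p ℕ.+ j)           ≈⟨ Kθ-small pj<V ⟩
          0#                                        ∎

        same : ∀ {p} → p ℕ.+ j < V → fracDigit a (j ℕ.+ k) N′ p ≈ fracDigit a (suc (j ℕ.+ k)) N p
        same {p} pj<V = begin
          fracDigit a (j ℕ.+ k) N′ p
            ≈⟨ dot-extend (a ∘ (p ℕ.+_)) N′↓ (n≤1+n _) ⟨
          fracDigit a (suc (j ℕ.+ k)) N′ p
            ≈⟨ dot-+[]· (suc (j ℕ.+ k)) N c S (a ∘ (p ℕ.+_)) ⟩
          fracDigit a (suc (j ℕ.+ k)) N p + c * fracDigit a (suc (j ℕ.+ k)) S p
            ≈⟨ +-congˡ (trans (*-congˡ (Sθ-small pj<V)) (zeroʳ c)) ⟩
          fracDigit a (suc (j ℕ.+ k)) N p + 0#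
            ≈⟨ +-identityʳ _ ⟩
          fracDigit a (suc (j ℕ.+ k)) N p
            ∎

    reduce : ∀ j N → VanishesFrom (suc (j ℕ.+ k)) N →
      ∃ λ N′ → VanishesFrom k N′ × (∀ {p} → p ℕ.+ j < V → fracDigit a k N′ p ≈ fracDigit a (suc (j ℕ.+ k)) N p)
    reduce zero    N N↓ = eliminate-leading zero N N↓
    reduce (suc j) N N↓ with eliminate-leading (suc j) N N↓
    ... | N₁ , N₁↓ , same₁ with reduce j N₁ N₁↓
    ... | N₂ , N₂↓ , same₂ = N₂ , N₂↓ , λ {p} psj<V →
          trans (same₂ (<-trans (+-monoʳ-< p ≤-refl) psj<V)) (same₁ psj<V)

  agreement-descends : ∀ a g {n k K y N} → k < n → VanishesFrom (suc k) K → K k * y ≈ 1# →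
                       (∀ {p} → p < n → fracDigit a (suc k) K p ≈ 0#) →
                       VanishesFrom n N → Agrees a g n n N →
                       ∃ λ N′ → VanishesFrom k N′ × Agrees a g (suc k) k N′
  agreement-descends a g {k = k} {N = N} k<n K↓ unit Kθ-small N↓ agrees with m≤n⇒∃[o]m+o≡n k<n
  ... | j , ≡.refl = N′ , N′↓ , agrees′
    where
      open Reduction a K↓ unit Kθ-small

      reduction = reduce j N (≡.subst (λ m → VanishesFrom (suc m) N) (ℕₚ.+-comm k j) N↓)
      N′   = proj₁ reduction
      N′↓  = proj₁ (proj₂ reduction)
      same = proj₂ (proj₂ reduction)

      agrees′ : Agrees a g (suc k) k N′
      agrees′ {p} (s≤s p≤k) = begin
        fracDigit a k N′ p              ≈⟨ same (s≤s (+-monoˡ-≤ j p≤k)) ⟩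
        fracDigit a (suc (j ℕ.+ k)) N p ≡⟨ ≡.cong (λ m → fracDigit a (suc m) N p) (ℕₚ.+-comm j k) ⟩
        fracDigit a (suc (k ℕ.+ j)) N p ≈⟨ agrees (s≤s (≤-trans p≤k (m≤m+n k j))) ⟩
        g p                             ∎

  monomial-raises-degree : ¬ 1# ≈ 0# → ∀ {a g e N} → VanishesFrom e N → Agrees a g (suc e) (suc e) N →
                           (∀ {p} → p ≤ e → a (p ℕ.+ e) ≈ 0#) →
                           HasDegree e (N +[ 1# ]· monomial e) × Agrees a g (suc e) (suc e) (N +[ 1# ]· monomial e)
  monomial-raises-degree 1≉0 {a} {g} {e} {N} N↓ agrees aθ-gap = (M↓ , Me≉0) , agrees′
    where
      M = N +[ 1# ]· monomial e

      monomial↓ : VanishesFrom (suc e) (monomial e)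
      monomial↓ = ≡.subst (λ m → VanishesFrom m (monomial e)) (ℕₚ.+-comm e 1)
                          (shiftBy-vanishesFrom e (∷-vanishesFrom 1# λ _ → refl))

      M↓ : VanishesFrom (suc e) M
      M↓ e<k = trans (+-cong (N↓ (<⇒≤ e<k)) (trans (*-identityˡ _) (monomial↓ e<k))) (+-identityʳ 0#)

      Me≉0 : ¬ M e ≈ 0#
      Me≉0 Me≈0 = 1≉0 (begin
        1#                     ≈⟨ reflexive (≡.trans (≡.cong (monomial e) (≡.sym (ℕₚ.+-identityʳ e))) (shiftBy-+ e _ 0)) ⟨
        monomial e e           ≈⟨ *-identityˡ _ ⟨
        1# * monomial e e      ≈⟨ +-identityˡ _ ⟨
        0# + 1# * monomial e e ≈⟨ +-congʳ (N↓ ≤-refl) ⟨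
        M e                    ≈⟨ Me≈0 ⟩
        0#                     ∎)

      monomialθ-small : ∀ {p} → p ≤ e → fracDigit a (suc e) (monomial e) p ≈ 0#
      monomialθ-small {p} p≤e = dot-vanishes (suc e) λ k<1+e → term-vanishes (m≤n⇒m<n∨m≡n (s≤s⁻¹ k<1+e))
        where
          term-vanishes : ∀ {k} → k < e ⊎ k ≡ e → monomial e k * a (p ℕ.+ k) ≈ 0#
          term-vanishes (inj₁ k<e)    = trans (*-congʳ (shiftBy-below e _ k<e)) (zeroˡ _)
          term-vanishes (inj₂ ≡.refl) = trans (*-congˡ (aθ-gap p≤e)) (zeroʳ _)

      agrees′ : Agrees a g (suc e) (suc e) M
      agrees′ {p} (s≤s p≤e) = begin
        fracDigit a (suc e) M p                                            ≈⟨ dot-+[]· (suc e) N 1# (monomial e) (a ∘ (p ℕ.+_)) ⟩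
        fracDigit a (suc e) N p + 1# * fracDigit a (suc e) (monomial e) p ≈⟨ +-cong (agrees (s≤s p≤e)) (*-congˡ (monomialθ-small p≤e)) ⟩
        g p + 1# * 0#                                                      ≈⟨ +-congˡ (zeroʳ 1#) ⟩
        g p + 0#                                                           ≈⟨ +-identityʳ _ ⟩
        g p                                                                ∎

-- Finite fields

module FiniteField (F : CommutativeRing 0ℓ 0ℓ) {q} (FF : IsFiniteField F q) where
  open CommutativeRing F hiding (zero)
  open IsFiniteField FF
  open Polynomials F
  open Inverse count using (to; from; inverseʳ)
  open import Algebra.Properties.Ring ring using (-1*x≈-x)
  open import Algebra.Properties.AbelianGroup +-abelianGroup using (x∙y⁻¹≈ε⇒x≈y; x≈y⇒x∙y⁻¹≈ε; xyx⁻¹≈y)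
  open import Algebra.Properties.Semiring.Sum semiring using (sum; sum-cong-≋)
  open import Relation.Binary.Reasoning.Setoid setoid

  infix 4 _≈?_
  _≈?_ : Decidable _≈_
  _≈?_ = Dec.via-injection (Inverse⇒Injection count) Finₚ._≟_

  x+1≉x : ∀ x → ¬ x + 1# ≈ x
  x+1≉x x x+1≈x = 1≉0 (begin
    1#         ≈⟨ xyx⁻¹≈y x 1# ⟨
    x + 1# - x ≈⟨ +-congʳ x+1≈x ⟩
    x - x      ≈⟨ -‿inverseʳ x ⟩
    0#         ∎)

  ∃-vanishingFrom? : ∀ n {P : Seq → Set} → P Respects _≈ₛ_ → (∀ N → Dec (P N)) →
                     Dec (∃ λ N → VanishesFrom n N × P N)
  ∃-vanishingFrom? zero P-resp P? =
    Dec.map′ (λ P0 → (λ _ → 0#) , (λ _ → refl) , P0) (λ (N , N↓ , PN) → P-resp (λ _ → N↓ z≤n) PN) (P? λ _ → 0#)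
  ∃-vanishingFrom? (suc n) {P} P-resp P? =
    Dec.map′ cons uncons (Finₚ.any? λ c → ∃-vanishingFrom? n (P-resp ∘ ∷-congʳ (from c)) (P? ∘ (from c ∷ₛ_)))
    where
      cons : (∃ λ c → ∃ λ N → VanishesFrom n N × P (from c ∷ₛ N)) → ∃ λ N → VanishesFrom (suc n) N × P N
      cons (c , N , N↓ , PN) = from c ∷ₛ N , ∷-vanishesFrom (from c) N↓ , PN

      uncons : (∃ λ N → VanishesFrom (suc n) N × P N) → ∃ λ c → ∃ λ N → VanishesFrom n N × P (from c ∷ₛ N)
      uncons (N , N↓ , PN) = to (N 0) , N ∘ suc , N↓ ∘ s≤s , P-resp η PN
        where
          η : N ≈ₛ from (to (N 0)) ∷ₛ N ∘ suc
          η zero    = sym (inverseʳ ≡.refl)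
          η (suc k) = refl

  vanishesFrom⊎hasDegree≥ : ∀ r {n N} → VanishesFrom n N →
                            VanishesFrom r N ⊎ ∃ λ d → r ≤ d × d < n × HasDegree d N
  vanishesFrom⊎hasDegree≥ r {zero}      N↓ = inj₁ (λ _ → N↓ z≤n)
  vanishesFrom⊎hasDegree≥ r {suc n} {N} N↓ with N n ≈? 0# | r ℕ.≤? n
  ... | yes Nn≈0 | _       = Sum.map₂ (λ (d , r≤d , d<n , deg) → d , r≤d , m<n⇒m<1+n d<n , deg)
                                       (vanishesFrom⊎hasDegree≥ r (vanishesFrom-pred N↓ Nn≈0))
  ... | no  Nn≉0 | yes r≤n = inj₂ (n , r≤n , ≤-refl , N↓ , Nn≉0)
  ... | no  _    | no  r≰n = inj₁ (λ r≤k → N↓ (≤-trans (≰⇒> r≰n) r≤k))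

  agrees? : ∀ a g ℓ n N → Dec (Agrees a g ℓ n N)
  agrees? a g ℓ n N = allUpTo? (λ p → fracDigit a n N p ≈? g p) ℓ

  module Greedy (a : Seq) where

    Avoids : Seq → ℕ → Set
    Avoids g n = ∀ N → VanishesFrom n N → ¬ Agrees a g (suc n) n N

    next-digit-determined : ∀ g n → (∀ {k} → k < n → Avoids g k) →
                            ∀ {N M} → VanishesFrom n N → VanishesFrom n M → Agrees a g n n N → Agrees a g n n M →
                            fracDigit a n N n ≈ fracDigit a n M n
    next-digit-determined g n avoids {N} {M} N↓ M↓ agN agM = conclude (vanishesFrom⊎hasDegree≥ 0 K↓)
      where
        K = N +[ - 1# ]· M

        K↓ : VanishesFrom n K
        K↓ n≤k = trans (+-cong (N↓ n≤k) (trans (*-congˡ (M↓ n≤k)) (zeroʳ _))) (+-identityʳ 0#)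

        Kθ : ∀ p → fracDigit a n K p ≈ fracDigit a n N p - fracDigit a n M p
        Kθ p = trans (dot-+[]· n N (- 1#) M (a ∘ (p ℕ.+_))) (+-congˡ (-1*x≈-x _))

        Kθ-small : ∀ {p} → p < n → fracDigit a n K p ≈ 0#
        Kθ-small p<n = trans (Kθ _) (x≈y⇒x∙y⁻¹≈ε (trans (agN p<n) (sym (agM p<n))))

        conclude : VanishesFrom 0 K ⊎ ∃ (λ k → 0 ≤ k × k < n × HasDegree k K) → fracDigit a n N n ≈ fracDigit a n M n
        conclude (inj₁ K≈0) = x∙y⁻¹≈ε⇒x≈y _ _
          (trans (sym (Kθ n)) (dot-vanishes n {K} {a ∘ (n ℕ.+_)} λ _ → trans (*-congʳ (K≈0 z≤n)) (zeroˡ _)))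
        conclude (inj₂ (k , _ , k<n , K↓′ , Kk≉0)) =
          let y , unit       = inverses (K k) Kk≉0
              N′ , N′↓ , agN′ = agreement-descends a g k<n K↓′ unit
                                  (λ {p} p<n → trans (sym (dot-extend (a ∘ (p ℕ.+_)) K↓′ k<n)) (Kθ-small p<n)) N↓ agN
          in ⊥-elim (avoids k<n N′ N′↓ agN′)

    ∃-agreeing? : ∀ h L → Dec (∃ λ N → VanishesFrom L N × Agrees a h L L N)
    ∃-agreeing? h L = ∃-vanishingFrom? L (agrees-respects {a} {h} {L} {L}) (agrees? a h L L)

    nextDigit : Seq → ℕ → Carrier
    nextDigit h L with ∃-agreeing? h L
    ... | yes (N₀ , _) = fracDigit a L N₀ L + 1#
    ... | no  _        = 0#

    nextDigit-differs : ∀ h L {N} → VanishesFrom L N → Agrees a h L L N →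
                        ∃ λ N₀ → VanishesFrom L N₀ × Agrees a h L L N₀ × ¬ nextDigit h L ≈ fracDigit a L N₀ L
    nextDigit-differs h L N↓ agN with ∃-agreeing? h L
    ... | yes (N₀ , N₀↓ , agN₀) = N₀ , N₀↓ , agN₀ , x+1≉x _
    ... | no  none              = ⊥-elim (none (_ , N↓ , agN))

    -- greedyPrefix L holds the digits of greedy below L, making the course-of-values
    -- recursion defining greedy structural.
    greedyPrefix : ℕ → Seq
    greedyPrefix zero    _ = 0#
    greedyPrefix (suc L) p with p ℕ.≟ L
    ... | yes _ = nextDigit (greedyPrefix L) L
    ... | no  _ = greedyPrefix L p

    greedy : Seq
    greedy L = nextDigit (greedyPrefix L) L

    greedyPrefix≡greedy : ∀ {L p} → p < L → greedyPrefix L p ≡ greedy p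
    greedyPrefix≡greedy {suc L} {p} p<1+L with p ℕ.≟ L
    ... | yes ≡.refl = ≡.refl
    ... | no  p≢L    = greedyPrefix≡greedy (≤∧≢⇒< (s≤s⁻¹ p<1+L) p≢L)

    greedy-avoids : ∀ n → Avoids greedy n
    greedy-avoids = <-rec (Avoids greedy) step
      where
        step : ∀ n → (∀ {k} → k < n → Avoids greedy k) → Avoids greedy n
        step n avoids N N↓ agN =
          let N₀ , N₀↓ , agN₀ , differs = nextDigit-differs (greedyPrefix n) n N↓
                                            (agrees-local {a} {n = n} {N = N} (λ p<n → ≡.sym (greedyPrefix≡greedy p<n)) agN-n)
          in differs (trans (sym (agN ≤-refl))
                            (next-digit-determined greedy n avoids N↓ N₀↓ agN-n
                               (agrees-local {a} {n = n} {N = N₀} greedyPrefix≡greedy agN₀)))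
          where
            agN-n : Agrees a greedy n n N
            agN-n p<n = agN (m<n⇒m<1+n p<n)

  -- The fractional digits of Σ_i t ^ -(4 ^ i).
  lacunary : Seq
  lacunary x with isPowerOf4? (suc x)
  ... | yes _ = 1#
  ... | no  _ = 0#

  lacunary-power : ∀ m {x} → 4 ^ m ≡ suc x → lacunary x ≈ 1#
  lacunary-power m {x} 4^m≡1+x with isPowerOf4? (suc x)
  ... | yes _      = refl
  ... | no  ¬power = ⊥-elim (¬power (m , 4^m≡1+x))

  lacunary-gap : ∀ m {x} → 4 ^ m ≤ x → x ≤ 4 ^ m ℕ.+ 4 ^ m → lacunary x ≈ 0#
  lacunary-gap m {x} lo hi with isPowerOf4? (suc x)
  ... | yes power = ⊥-elim (powerOf4-gap m (s≤s lo) (≤-<-trans (s≤s hi) (1+[n+n]<4*n _ {{m^n≢0 4 m}})) power)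
  ... | no  _     = refl

  lacunary-solvable : ∀ m g → ∃ λ N → VanishesFrom (4 ^ m) N × Agrees lacunary g (4 ^ m) (4 ^ m) N
  lacunary-solvable m g =
    ≡.subst (λ n → ∃ λ N → VanishesFrom n N × Agrees lacunary g n n N) 1+P≡4^m
            (hankel-solvable P {lacunary} (lacunary-power m (≡.sym 1+P≡4^m)) gap g)
    where
      P = ℕ.pred (4 ^ m)

      1+P≡4^m : suc P ≡ 4 ^ m
      1+P≡4^m = suc-pred (4 ^ m) {{m^n≢0 4 m}}

      gap : ∀ {x} → P < x → x ≤ P ℕ.+ P → lacunary x ≈ 0#
      gap {x} P<x x≤P+P = lacunary-gap m (≡.subst (_≤ x) 1+P≡4^m P<x)
        (≤-trans x≤P+P (≡.subst (λ n → P ℕ.+ P ≤ n ℕ.+ n) 1+P≡4^m (+-mono-≤ (n≤1+n P) (n≤1+n P))))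

  lacunary-approximable : ∀ g R₀ → ∃ λ d → ∃ λ N → R₀ ≤ d × HasDegree d N × Agrees lacunary g (suc d) (suc d) N
  lacunary-approximable g R₀ with lacunary-solvable (suc R₀) g
  ... | N , N↓ , agrees with vanishesFrom⊎hasDegree≥ R₀ N↓
  ... | inj₂ (d , R₀≤d , d<E , deg) = d , N , R₀≤d , deg , λ {p} p≤d →
    trans (sym (dot-extend (lacunary ∘ (p ℕ.+_)) (proj₁ deg) d<E)) (agrees (≤-trans p≤d d<E))
  ... | inj₁ N↓R₀ = e , _ , R₀≤e , monomial-raises-degree 1≉0 {lacunary} {g} N↓e agrees-e gap-e
    where
      e = 4 ^ R₀

      R₀≤e : R₀ ≤ e
      R₀≤e = <⇒≤ (n<4^n R₀)

      e<E : e < 4 ^ suc R₀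
      e<E = ^-monoʳ-< 4 (s≤s (s≤s z≤n)) (n<1+n R₀)

      N↓e : VanishesFrom e N
      N↓e e≤k = N↓R₀ (≤-trans R₀≤e e≤k)

      agrees-e : Agrees lacunary g (suc e) (suc e) N
      agrees-e {p} p≤e = begin
        fracDigit lacunary (suc e) N p        ≈⟨ dot-extend (lacunary ∘ (p ℕ.+_)) N↓e (n≤1+n e) ⟩
        fracDigit lacunary e N p              ≈⟨ dot-extend (lacunary ∘ (p ℕ.+_)) N↓e (<⇒≤ e<E) ⟨
        fracDigit lacunary (4 ^ suc R₀) N p   ≈⟨ agrees (≤-trans p≤e e<E) ⟩
        g p                                   ∎

      gap-e : ∀ {p} → p ≤ e → lacunary (p ℕ.+ e) ≈ 0#
      gap-e {p} p≤e = lacunary-gap R₀ (m≤n+m e p) (+-monoˡ-≤ e p≤e)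

  open LaurentSeries F

  digits : Laurent → Seq
  digits θ p = coeff θ -[1+ p ]

  fromDigits : Seq → Laurent
  fromDigits g = record { coeff = coefficient ; bounded = + 0 , vanishes }
    where
      coefficient : ℤ → Carrier
      coefficient (+ _)    = 0#
      coefficient -[1+ p ] = g p

      vanishes : ∀ j → + 0 ℤ.< j → coefficient j ≈ 0#
      vanishes (+ _)    _ = refl
      vanishes -[1+ _ ] ()

  toSeq : NonzeroPoly → Seq
  toSeq N k with k ℕ.<? suc (deg N)
  ... | yes k<n = cf N (Fin.fromℕ< k<n)
  ... | no  _   = 0#

  toSeq-vanishesFrom : ∀ N → VanishesFrom (suc (deg N)) (toSeq N)
  toSeq-vanishesFrom N {k} n≤k with k ℕ.<? suc (deg N)
  ... | yes k<n = ⊥-elim (≤⇒≯ n≤k k<n)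
  ... | no  _   = refl

  cf≈toSeq : ∀ N i → cf N i ≈ toSeq N (toℕ i)
  cf≈toSeq N i with toℕ i ℕ.<? suc (deg N)
  ... | yes i<n = reflexive (≡.cong (cf N) (≡.sym (Finₚ.fromℕ<-toℕ i i<n)))
  ... | no  i≮n = ⊥-elim (i≮n (Finₚ.toℕ<n i))

  fromHasDegree : ∀ {d N} → HasDegree d N → NonzeroPoly
  fromHasDegree {d} {N} (_ , Nd≉0) = record
    { deg    = d
    ; cf     = N ∘ toℕ
    ; lead≉0 = Nd≉0 ∘ trans (reflexive (≡.cong N (≡.sym (Finₚ.toℕ-fromℕ d))))
    }

  sumFin≡sum : ∀ {n} (f : Fin n → Carrier) → sumFin f ≡ sum f
  sumFin≡sum {zero}  f = ≡.refl
  sumFin≡sum {suc n} f = ≡.cong (λ s → f Fin.zero + s) (sumFin≡sum (f ∘ Fin.suc))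

  shiftedCoeff≈ : ∀ θ γ N {Nₛ} → (∀ i → cf N i ≈ Nₛ (toℕ i)) → ∀ p →
                  shiftedCoeff N θ γ -[1+ p ] ≈ fracDigit (digits θ) (suc (deg N)) Nₛ p - digits γ p
  shiftedCoeff≈ θ γ N {Nₛ} cf≈ p = +-congʳ (begin
    sumFin (λ i → cf N i * coeff θ (-[1+ p ] ℤ.- + toℕ i))
      ≡⟨ sumFin≡sum (λ i → cf N i * coeff θ (-[1+ p ] ℤ.- + toℕ i)) ⟩
    sum (λ i → cf N i * coeff θ (-[1+ p ] ℤ.- + toℕ i))
      ≈⟨ sum-cong-≋ {n = suc (deg N)} (λ i → *-cong (cf≈ i) (reflexive (≡.cong (coeff θ) (-[1+m]-n≡-[1+m+n] p (toℕ i))))) ⟩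
    fracDigit (digits θ) (suc (deg N)) Nₛ p
      ∎)

  prodLe⇒agrees : ∀ ℓ {θ γ} N → ProdLe N θ γ -[1+ ℓ ] →
                  Agrees (digits θ) (digits γ) (ℓ ℕ.+ deg N) (suc (deg N)) (toSeq N)
  prodLe⇒agrees ℓ {θ} {γ} N small {p} p<ℓ+d = x∙y⁻¹≈ε⇒x≈y _ _ (begin
    fracDigit (digits θ) (suc (deg N)) (toSeq N) p - digits γ p ≈⟨ shiftedCoeff≈ θ γ N {toSeq N} (cf≈toSeq N) p ⟨
    shiftedCoeff N θ γ -[1+ p ]                                ≈⟨ small -[1+ p ] below ⟩
    0#                                                         ∎)
    where below = ≡.subst (ℤ._< -[1+ p ]) (≡.sym (-[1+m]-n≡-[1+m+n] ℓ (deg N))) (ℤ.-<- p<ℓ+d)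

  agrees⇒prodLe : ∀ ℓ {θ γ} N {Nₛ} → (∀ i → cf N i ≈ Nₛ (toℕ i)) →
                  Agrees (digits θ) (digits γ) (ℓ ℕ.+ deg N) (suc (deg N)) Nₛ → ProdLe N θ γ -[1+ ℓ ]
  agrees⇒prodLe ℓ N cf≈ agrees (+ n) _ with + n ℤ.<? + 0
  ... | yes (ℤ.+<+ ())
  ... | no  _ = refl
  agrees⇒prodLe ℓ {θ} {γ} N {Nₛ} cf≈ agrees -[1+ p ] lt with ≡.subst (ℤ._< -[1+ p ]) (-[1+m]-n≡-[1+m+n] ℓ (deg N)) lt
  ... | ℤ.-<- p<ℓ+d = trans (shiftedCoeff≈ θ γ N {Nₛ} cf≈ p) (x≈y⇒x∙y⁻¹≈ε (agrees p<ℓ+d))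

  greedy-liminf : ∀ θ → LiminfGe θ (fromDigits (Greedy.greedy (digits θ))) -[1+ 1 ]
  greedy-liminf θ ¬bounded = ¬bounded (0 , λ N _ →
    greedy-avoids (suc (deg N)) (toSeq N) (toSeq-vanishesFrom N) ∘ prodLe⇒agrees 2 {θ} {fromDigits greedy} N)
    where open Greedy (digits θ)

  lacunary-liminf : ∀ γ → LiminfLe (fromDigits lacunary) γ -[1+ 1 ]
  lacunary-liminf γ R₀ ¬approximable =
    let d , N , R₀≤d , deg , agrees = lacunary-approximable (digits γ) R₀
    in ¬approximable ( fromHasDegree deg
                     , R₀≤d
                     , agrees⇒prodLe 1 {fromDigits lacunary} {γ} (fromHasDegree deg) {N} (λ _ → refl) agrees)

theorem3p11 : (F : CommutativeRing 0ℓ 0ℓ) (q : ℕ) → IsFiniteField F q →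
    let open LaurentSeries F in
    (∀ (θ : Laurent) → ¬ ¬ (∃ λ (γ : Laurent) → LiminfGe θ γ -[1+ 1 ]))
    × ¬ ¬ (∃ λ (θ : Laurent) → ∀ (γ : Laurent) → LiminfLe θ γ -[1+ 1 ])
theorem3p11 F q FF =
    (λ θ ¬γ → ¬γ (fromDigits (Greedy.greedy (digits θ)) , greedy-liminf θ))
  , λ ¬θ → ¬θ (fromDigits lacunary , lacunary-liminf)
  where open FiniteField F FF
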